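{- For a connected simple graph $\Gamma$ on $[n]$, the polytopes $$Q_{\Gamma}=\sum_{\substack{S\subseteq[n]\\ \Gamma|_S\text{ connected}}}\Delta_S\qquad\text{and}\qquad Q^L_{\Gamma}=\sum_{\substack{S\subseteq[n]\\ \Gamma|_S\cong L_{|S|}}}\Delta_S$$ are normally equivalent (have the same normal fan).
   Context: $\Delta_S=\mathrm{conv}\{e_s:s\in S\}\subset\mathbb{R}^n$ for the standard basis vectors $e_s$, with sums being Minkowski sums over nonempty $S$. $\Gamma|_S$ is the induced subgraph on $S$, and $L_r$ is the path graph on $[r]$ with edges $\{i,i+1\}$.
   Formalization: Points of $Q_{\Gamma}$ and $Q^L_{\Gamma}$ and the linear functionals defining their normal fans have rational coordinates, in ℚ^n rather than ℝ^n. -}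

module Defs where

open import Data.Nat using (ℕ; zero; suc)
open import Data.Bool using (Bool; true; false)
open import Data.Fin using (Fin; toℕ)
open import Data.Fin.Subset using (Subset; _∈_; _∉_; ∣_∣; Nonempty; inside; outside)
open import Data.List using (List; []; _∷_; map; _++_; foldr)
open import Data.Vec using (Vec; []; _∷_)
open import Data.Rational using (ℚ; 0ℚ; 1ℚ; _+_; _*_; _≤_)
open import Data.Product using (Σ; _×_; ∃)
open import Data.Sum using (_⊎_)
open import Relation.Nullary using (¬_)
open import Relation.Binary.PropositionalEquality using (_≡_)
open import Function.Bundles using (_⇔_)
open import Function.Definitions using (Injective)

record SimpleGraph (n : ℕ) : Set where
  field
    Adj   : Fin n → Fin n → Bool
    sym   : ∀ u v → Adj u v ≡ Adj v u
    irrfl : ∀ u → Adj u u ≡ false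
open SimpleGraph public

data WalkIn {n : ℕ} (Γ : SimpleGraph n) (S : Subset n) : Fin n → Fin n → Set where
  here : ∀ {u} → u ∈ S → WalkIn Γ S u u
  step : ∀ {u w v} → u ∈ S → Adj Γ u w ≡ true → WalkIn Γ S w v → WalkIn Γ S u v

InducedConnected : {n : ℕ} → SimpleGraph n → Subset n → Set
InducedConnected Γ S = Nonempty S × (∀ u v → u ∈ S → v ∈ S → WalkIn Γ S u v)

Connected : {n : ℕ} → SimpleGraph n → Set
Connected {n} Γ = InducedConnected Γ Data.Fin.Subset.⊤

PathAdj : {r : ℕ} → Fin r → Fin r → Set
PathAdj i j = (toℕ j ≡ suc (toℕ i)) ⊎ (toℕ i ≡ suc (toℕ j))

InducedIsPath : {n : ℕ} → SimpleGraph n → Subset n → Set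
InducedIsPath Γ S =
  Nonempty S ×
  Σ (Fin ∣ S ∣ → Fin _) λ f →
    Injective _≡_ _≡_ f ×
    (∀ i → f i ∈ S) ×
    (∀ v → v ∈ S → ∃ λ i → f i ≡ v) ×
    (∀ i j → (Adj Γ (f i) (f j) ≡ true) ⇔ PathAdj i j)

Point : ℕ → Set
Point n = Fin n → ℚ

zeroP : {n : ℕ} → Point n
zeroP _ = 0ℚ

_+P_ : {n : ℕ} → Point n → Point n → Point n
(x +P y) i = x i + y i

sumP : {n : ℕ} → List (Point n) → Point n
sumP = foldr _+P_ zeroP

allSubsets : (n : ℕ) → List (Subset n)
allSubsets zero = [] ∷ []
allSubsets (suc n) = map (inside ∷_) (allSubsets n) ++ map (outside ∷_) (allSubsets n)

coordSum : {n : ℕ} → Point n → ℚ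
coordSum {zero}  x = 0ℚ
coordSum {suc n} x = x Data.Fin.zero + coordSum (λ i → x (Data.Fin.suc i))

InSimplex : {n : ℕ} → Subset n → Point n → Set
InSimplex S x = (∀ i → 0ℚ ≤ x i) × (∀ i → i ∉ S → x i ≡ 0ℚ) × (coordSum x ≡ 1ℚ)

MinkowskiSimplexSum : {n : ℕ} → (Subset n → Set) → Point n → Set
MinkowskiSimplexSum {n} P x =
  Σ (Subset n → Point n) λ y →
    (∀ S → P S → InSimplex S (y S)) ×
    (∀ S → ¬ P S → y S ≡ zeroP) ×
    (x ≡ sumP (map y (allSubsets n)))

_·_ : {n : ℕ} → Point n → Point n → ℚ
w · x = coordSum (λ i → w i * x i)

InFace : {n : ℕ} → (Point n → Set) → Point n → Point n → Set
InFace P w x = P x × (∀ y → P y → (w · y) ≤ (w · x))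

-- w and w' lie in the same (relatively open) cone of the normal fan of P
SameNormalCone : {n : ℕ} → (Point n → Set) → Point n → Point n → Set
SameNormalCone P w w' = ∀ x → InFace P w x ⇔ InFace P w' x

NormallyEquivalent : {n : ℕ} → (Point n → Set) → (Point n → Set) → Set
NormallyEquivalent P Q = ∀ w w' → SameNormalCone P w w' ⇔ SameNormalCone Q w w'

Q-Γ : {n : ℕ} → SimpleGraph n → Point n → Set
Q-Γ Γ = MinkowskiSimplexSum (InducedConnected Γ)

QL-Γ : {n : ℕ} → SimpleGraph n → Point n → Set
QL-Γ Γ = MinkowskiSimplexSum (InducedIsPath Γ)

-- The face of a Minkowski sum of simplices maximising w is the sum of the faces of its summands, and the face
-- of Δ_T maximising w is the simplex on argmax_T w.  Hence w and w' lie in the same normal cone of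
-- Σ_{P T} Δ_T exactly when argmax_T w = argmax_T w' for every T with P T.  Induced paths are connected, and any
-- two vertices of a connected induced subgraph Γ|_T lie on an induced path inside T (shortcut a walk between
-- them), so comparing argmaxes over connected sets is the same as comparing them over induced paths.
module Submission where

open import Algebra.Bundles using (CommutativeRing)
open import Data.Bool using (true; false)
import Data.Bool as Bool
open import Data.Fin using (Fin; zero; suc; inject₁)
import Data.Fin as Fin
open import Data.Fin.Properties using (toℕ-inject₁)
open import Data.Fin.Subset using (Subset; _∈_; _∉_; _⊆_; ∣_∣; Nonempty; inside; outside; ⁅_⁆; _∪_)
  renaming (⊥ to ∅)
open import Data.Fin.Subset.Properties
  using (_∈?_; x∈p∪q⁺; x∈p∪q⁻; x∈⁅x⁆; x∈⁅y⁆⇒x≡y; ∉⊥; ∣⊥∣≡0; ∪-identityˡ)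
open import Data.List using (List; []; _∷_; map; filter; allFin; length; lookup)
open import Data.List.Membership.Propositional using (lose) renaming (_∈_ to _∈ˡ_)
open import Data.List.Membership.Propositional.Properties
  using (∈-lookup; ∈-filter⁺; ∈-allFin; ∈-++⁺ˡ; ∈-++⁺ʳ; ∈-map⁺)
open import Data.List.Relation.Unary.All as All using (All; []; _∷_)
open import Data.List.Relation.Unary.All.Properties using (all-filter)
open import Data.List.Relation.Unary.AllPairs using ([]; _∷_)
open import Data.List.Relation.Unary.Any as Any using (Any; here; there; any?)
open import Data.List.Relation.Unary.Any.Properties using (lookup-index)
open import Data.List.Relation.Unary.Unique.Propositional using (Unique)
open import Data.Nat using (ℕ; zero; suc)
open import Data.Nat.Properties using (suc-injective)
open import Data.Product using (_×_; ∃; _,_; proj₁; proj₂)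
open import Data.Product.Function.NonDependent.Propositional using (_×-⇔_)
open import Data.Rational using (ℚ; 0ℚ; 1ℚ; _+_; _*_; _≤_; _<_; _≤?_; _<?_; _≟_; positive; nonNegative)
open import Data.Rational.Properties
open import Data.Sum using (_⊎_; inj₁; inj₂; swap) renaming (map to map⊎)
open import Data.Vec.Base as Vec using ([]; _∷_)
open import Data.Vec.Properties using (≡-dec)
open import Defs hiding (sym)
open import Function.Base using (_∘_)
open import Function.Bundles using (_⇔_; mk⇔; Equivalence)
open import Function.Definitions using (Injective)
open import Function.Properties.Equivalence using () renaming (trans to ⇔-trans; sym to ⇔-sym)
open import Relation.Binary.Bundles using (DecTotalOrder)
open import Relation.Binary.PropositionalEquality
  using (_≡_; _≢_; refl; sym; trans; cong; cong₂; subst; subst₂; module ≡-Reasoning)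
open import Relation.Nullary using (¬_; Dec; yes; no)
open import Relation.Nullary.Decidable using (_⊎-dec_; decidable-stable; ¬¬-excluded-middle)
open import Relation.Nullary.Negation using (¬¬-map; contradiction)

open import Algebra.Properties.Semiring.Sum (CommutativeRing.semiring +-*-commutativeRing)
  using (sum; ∑-distrib-+; *-distribˡ-sum)
open import Data.List.Extrema (DecTotalOrder.totalOrder ≤-decTotalOrder) using (argmax; argmax-all; f[xs]≤f[argmax])

private
  variable
    n : ℕ
    A : Set
    Γ : SimpleGraph n
    S T : Subset n
    a i j u v x : Fin n
    m p q : ℚ
    f g w w' y : Point n
    P : Subset n → Set
    z : Subset n → Point n

≤-stable : ¬ ¬ (p ≤ q) → p ≤ q
≤-stable = decidable-stable (_ ≤? _)

≤∧≢⇒< : p ≤ q → q ≢ p → p < q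
≤∧≢⇒< {p} {q} p≤q q≢p = decidable-stable (p <? q) (λ p≮q → q≢p (≤-antisym (≮⇒≥ p≮q) p≤q))

*-zeroʳ-≡ : ∀ p q {r} → r ≡ 0ℚ → p * r ≡ q * r
*-zeroʳ-≡ p q refl = trans (*-zeroʳ p) (sym (*-zeroʳ q))

coordSum≡sum : (x : Point n) → coordSum x ≡ sum x
coordSum≡sum {zero}  x = refl
coordSum≡sum {suc n} x = cong (x zero +_) (coordSum≡sum (x ∘ suc))

coordSum-cong : (∀ i → f i ≡ g i) → coordSum f ≡ coordSum g
coordSum-cong {zero}  eq = refl
coordSum-cong {suc n} eq = cong₂ _+_ (eq zero) (coordSum-cong (eq ∘ suc))

coordSum-zeros : (∀ i → f i ≡ 0ℚ) → coordSum f ≡ 0ℚ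
coordSum-zeros {zero}  eq = refl
coordSum-zeros {suc n} eq = trans (cong₂ _+_ (eq zero) (coordSum-zeros (eq ∘ suc))) (+-identityʳ 0ℚ)

coordSum-+ : (f g : Point n) → coordSum (f +P g) ≡ coordSum f + coordSum g
coordSum-+ f g = begin
  coordSum (f +P g)       ≡⟨ coordSum≡sum (f +P g) ⟩
  sum (f +P g)            ≡⟨ ∑-distrib-+ f g ⟩
  sum f + sum g           ≡⟨ cong₂ _+_ (coordSum≡sum f) (coordSum≡sum g) ⟨
  coordSum f + coordSum g ∎
  where open ≡-Reasoning

coordSum-scale : (c : ℚ) (f : Point n) → coordSum (λ i → c * f i) ≡ c * coordSum f
coordSum-scale c f = begin
  coordSum (λ i → c * f i) ≡⟨ coordSum≡sum (λ i → c * f i) ⟩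
  sum (λ i → c * f i)      ≡⟨ *-distribˡ-sum c f ⟨
  c * sum f                ≡⟨ cong (c *_) (coordSum≡sum f) ⟨
  c * coordSum f           ∎
  where open ≡-Reasoning

coordSum-mono : (∀ i → f i ≤ g i) → coordSum f ≤ coordSum g
coordSum-mono {zero}  le = ≤-refl
coordSum-mono {suc n} le = +-mono-≤ (le zero) (coordSum-mono (le ∘ suc))

coordSum-mono-< : (∀ i → f i ≤ g i) → (k : Fin n) → f k < g k → coordSum f < coordSum g
coordSum-mono-< le zero    lt = +-mono-<-≤ lt (coordSum-mono (le ∘ suc))
coordSum-mono-< le (suc k) lt = +-mono-≤-< (le zero) (coordSum-mono-< (le ∘ suc) k lt)

·-+P : (w f g : Point n) → w · (f +P g) ≡ w · f + w · g
·-+P w f g =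
  trans (coordSum-cong (λ i → *-distribˡ-+ (w i) (f i) (g i))) (coordSum-+ (λ i → w i * f i) (λ i → w i * g i))

e : Fin n → Point n
e zero    zero    = 1ℚ
e zero    (suc i) = 0ℚ
e (suc j) zero    = 0ℚ
e (suc j) (suc i) = e j i

·-e : (w : Point n) (j : Fin n) → w · e j ≡ w j
·-e {suc n} w zero =
  trans (cong₂ _+_ (*-identityʳ (w zero)) (coordSum-zeros (λ i → *-zeroʳ (w (suc i))))) (+-identityʳ (w zero))
·-e {suc n} w (suc j) = trans (cong₂ _+_ (*-zeroʳ (w zero)) (·-e (w ∘ suc) j)) (+-identityˡ (w (suc j)))

e-nonneg : (j i : Fin n) → 0ℚ ≤ e j i
e-nonneg zero    zero    = nonNegative⁻¹ 1ℚ
e-nonneg zero    (suc i) = ≤-refl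
e-nonneg (suc j) zero    = ≤-refl
e-nonneg (suc j) (suc i) = e-nonneg j i

e-off : i ≢ j → e j i ≡ 0ℚ
e-off {i = zero}  {zero}  i≢j = contradiction refl i≢j
e-off {i = zero}  {suc j} i≢j = refl
e-off {i = suc i} {zero}  i≢j = refl
e-off {i = suc i} {suc j} i≢j = e-off (i≢j ∘ cong suc)

coordSum-e : (j : Fin n) → coordSum (e j) ≡ 1ℚ
coordSum-e j = trans (coordSum-cong (λ i → sym (*-identityˡ (e j i)))) (·-e (λ _ → 1ℚ) j)

e-inSimplex : j ∈ T → InSimplex T (e j)
e-inSimplex {j = j} j∈T = e-nonneg j , (λ i i∉T → e-off {i = i} {j} (λ { refl → i∉T j∈T })) , coordSum-e j

inSimplex-support⊆ : InSimplex T y → y i ≢ 0ℚ → i ∈ T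
inSimplex-support⊆ {T = T} {i = i} (_ , outside-zero , _) yi≢0 =
  decidable-stable (i ∈? T) (yi≢0 ∘ outside-zero i)

simplex-termwise-bound : InSimplex T y → (∀ i → i ∈ T → w i ≤ m) → ∀ i → w i * y i ≤ m * y i
simplex-termwise-bound {T = T} {y} {w} {m} (nonneg , outside-zero , _) bound i with i ∈? T
... | yes i∈T = *-monoʳ-≤-nonNeg (y i) {{nonNegative (nonneg i)}} (bound i i∈T)
... | no  i∉T = ≤-reflexive (*-zeroʳ-≡ (w i) m (outside-zero i i∉T))

coordSum-scale-simplex : InSimplex T y → coordSum (λ i → m * y i) ≡ m
coordSum-scale-simplex {y = y} {m = m} (_ , _ , total) =
  trans (coordSum-scale m y) (trans (cong (m *_) total) (*-identityʳ m))

simplex-bound : InSimplex T y → (∀ i → i ∈ T → w i ≤ m) → w · y ≤ m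
simplex-bound y∈Δ bound =
  ≤-trans (coordSum-mono (simplex-termwise-bound y∈Δ bound)) (≤-reflexive (coordSum-scale-simplex y∈Δ))

IsArgmax : Point n → Subset n → Fin n → Set
IsArgmax w T i = i ∈ T × (∀ j → j ∈ T → w j ≤ w i)

argmax-exists : (w : Point n) → Nonempty T → ∃ (IsArgmax w T)
argmax-exists {n} {T} w (i₀ , i₀∈T) =
  argmax w i₀ elements , argmax-all w i₀∈T (all-filter (_∈? T) (allFin n)) ,
  λ j j∈T → All.lookup (f[xs]≤f[argmax] i₀ elements) (∈-filter⁺ (_∈? T) (∈-allFin j) j∈T)
  where
    elements : List (Fin n)
    elements = filter (_∈? T) (allFin n)

argmax⇒e-inFace : IsArgmax w T i → InFace (InSimplex T) w (e i)
argmax⇒e-inFace {w = w} {i = i} (i∈T , max) =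
  e-inSimplex i∈T , λ y y∈Δ → subst (w · y ≤_) (sym (·-e w i)) (simplex-bound y∈Δ max)

e-inFace⇒argmax : i ∈ T → InFace (InSimplex T) w (e i) → IsArgmax w T i
e-inFace⇒argmax {i = i} {w = w} i∈T (_ , max) =
  i∈T , λ j j∈T → subst₂ _≤_ (·-e w j) (·-e w i) (max (e j) (e-inSimplex j∈T))

inFace-support⇒argmax : IsArgmax w T a → InFace (InSimplex T) w y → y i ≢ 0ℚ → IsArgmax w T i
inFace-support⇒argmax {w = w} {a = a} {y = y} {i} (a∈T , a-max) (y∈Δ , maximal) yi≢0 =
  inSimplex-support⊆ y∈Δ yi≢0 , λ j j∈T → ≤-trans (a-max j j∈T) wa≤wi
  where
    open ≤-Reasoning
    wa≤wi : w a ≤ w i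
    wa≤wi = ≮⇒≥ λ wi<wa → <-irrefl refl (begin-strict
      w a                        ≡⟨ ·-e w a ⟨
      w · e a                    ≤⟨ maximal (e a) (e-inSimplex a∈T) ⟩
      w · y                      <⟨ coordSum-mono-< (simplex-termwise-bound y∈Δ a-max) i
                                      (*-monoˡ-<-pos (y i) {{positive (≤∧≢⇒< (proj₁ y∈Δ i) yi≢0)}} wi<wa) ⟩
      coordSum (λ k → w a * y k) ≡⟨ coordSum-scale-simplex y∈Δ ⟩
      w a                        ∎)

support⊆argmax⇒inFace : IsArgmax w T a → InSimplex T y → (∀ i → y i ≢ 0ℚ → IsArgmax w T i) →
                        InFace (InSimplex T) w y
support⊆argmax⇒inFace {w = w} {a = a} {y = y} (a∈T , a-max) y∈Δ support =
  y∈Δ , λ y' y'∈Δ → ≤-trans (simplex-bound y'∈Δ a-max) (≤-reflexive (sym w·y≡wa))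
  where
    flat : ∀ k → w k * y k ≡ w a * y k
    flat k with y k ≟ 0ℚ
    ... | yes yk≡0 = *-zeroʳ-≡ (w k) (w a) yk≡0
    ... | no  yk≢0 with support k yk≢0
    ...   | k∈T , k-max = cong (_* y k) (≤-antisym (a-max k k∈T) (k-max a a∈T))
    w·y≡wa : w · y ≡ w a
    w·y≡wa = trans (coordSum-cong flat) (coordSum-scale-simplex y∈Δ)

inFace-transfer : Nonempty T → (∀ i → IsArgmax w T i → IsArgmax w' T i) →
                  InFace (InSimplex T) w y → InFace (InSimplex T) w' y
inFace-transfer {w = w} {w'} nonempty argmax⊆ y∈face
  with argmax-exists w nonempty | argmax-exists w' nonempty
... | _ , a-argmax | _ , a'-argmax = support⊆argmax⇒inFace a'-argmax (proj₁ y∈face)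
  (λ i yi≢0 → argmax⊆ i (inFace-support⇒argmax a-argmax y∈face yi≢0))

module _ (w : Point n) {u v : A → Point n} (le : ∀ x → w · u x ≤ w · v x) where

  ·-sumP-mono : (L : List A) → w · sumP (map u L) ≤ w · sumP (map v L)
  ·-sumP-mono []      = ≤-refl
  ·-sumP-mono (y ∷ L) =
    subst₂ _≤_ (sym (·-+P w (u y) _)) (sym (·-+P w (v y) _)) (+-mono-≤ (le y) (·-sumP-mono L))

  ·-sumP-mono-< : {x : A} {L : List A} → x ∈ˡ L → w · u x < w · v x →
                  w · sumP (map u L) < w · sumP (map v L)
  ·-sumP-mono-< {L = y ∷ L} (here refl) lt =
    subst₂ _<_ (sym (·-+P w (u y) _)) (sym (·-+P w (v y) _)) (+-mono-<-≤ lt (·-sumP-mono L))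
  ·-sumP-mono-< {L = y ∷ L} (there x∈L) lt =
    subst₂ _<_ (sym (·-+P w (u y) _)) (sym (·-+P w (v y) _)) (+-mono-≤-< (le y) (·-sumP-mono-< x∈L lt))

∈-allSubsets : (T : Subset n) → T ∈ˡ allSubsets n
∈-allSubsets []                  = here refl
∈-allSubsets (true  ∷ T)         = ∈-++⁺ˡ (∈-map⁺ (inside ∷_) (∈-allSubsets T))
∈-allSubsets {suc n} (false ∷ T) =
  ∈-++⁺ʳ (map (inside ∷_) (allSubsets n)) (∈-map⁺ (outside ∷_) (∈-allSubsets T))

¬¬-∀-Subset : {Q : Subset n → Set} → (∀ T → ¬ ¬ Q T) → ¬ ¬ (∀ T → Q T)
¬¬-∀-Subset {zero}  ¬¬Q ¬∀Q = ¬¬Q [] λ Q[] → ¬∀Q λ { [] → Q[] }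
¬¬-∀-Subset {suc n} {Q} ¬¬Q ¬∀Q =
  ¬¬-∀-Subset {Q = λ T → Q (inside ∷ T) × Q (outside ∷ T)}
    (λ T ¬Q₂ → ¬¬Q (inside ∷ T) λ Q₁ → ¬¬Q (outside ∷ T) λ Q₀ → ¬Q₂ (Q₁ , Q₀))
    (λ ∀Q₂ → ¬∀Q λ { (true ∷ T) → proj₁ (∀Q₂ T) ; (false ∷ T) → proj₂ (∀Q₂ T) })

Decomposition : (Subset n → Set) → (Subset n → Point n) → Set
Decomposition P z = (∀ T → P T → InSimplex T (z T)) × (∀ T → ¬ P T → z T ≡ zeroP)

total : (Subset n → Point n) → Point n
total {n} z = sumP (map z (allSubsets n))

decomposition⇒∈sum : Decomposition P z → MinkowskiSimplexSum P (total z)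
decomposition⇒∈sum {z = z} (z∈Δ , z-zero) = z , z∈Δ , z-zero , refl

_≟ˢ_ : (S T : Subset n) → Dec (S ≡ T)
_≟ˢ_ = ≡-dec Bool._≟_

update : (Subset n → Point n) → Subset n → Point n → Subset n → Point n
update z T y S with S ≟ˢ T
... | yes _ = y
... | no  _ = z S

update-here : (z : Subset n → Point n) (T : Subset n) (y : Point n) → update z T y T ≡ y
update-here z T y with T ≟ˢ T
... | yes _   = refl
... | no  T≢T = contradiction refl T≢T

update-preserves : (Q : Subset n → Point n → Set) → (∀ S → Q S (z S)) → Q T y →
                   ∀ S → Q S (update z T y S)
update-preserves {T = T} Q Qz Qy S with S ≟ˢ T
... | yes refl = Qy
... | no  _    = Qz S

update-decomposition : Decomposition P z → P T → InSimplex T y → Decomposition P (update z T y)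
update-decomposition {P = P} (z∈Δ , z-zero) PT y∈Δ =
  update-preserves (λ S x → P S → InSimplex S x) z∈Δ (λ _ → y∈Δ) ,
  update-preserves (λ S x → ¬ P S → x ≡ zeroP) z-zero (contradiction PT)

total-inFace : Decomposition P z → (∀ T → P T → InFace (InSimplex T) w (z T)) →
               InFace (MinkowskiSimplexSum P) w (total z)
total-inFace {P = P} {z} {w} z-dec@(_ , z-zero) z∈face =
  decomposition⇒∈sum z-dec ,
  λ { _ (u , u∈Δ , u-zero , refl) → ·-sumP-mono w (summandwise u∈Δ u-zero) (allSubsets _) }
  where
    summandwise : {u : Subset _ → Point _} → (∀ T → P T → InSimplex T (u T)) →
                  (∀ T → ¬ P T → u T ≡ zeroP) → ∀ T → w · u T ≤ w · z T
    summandwise {u} u∈Δ u-zero T = ≤-stable (¬¬-map by-cases ¬¬-excluded-middle)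
      where
        by-cases : Dec (P T) → w · u T ≤ w · z T
        by-cases (yes PT) = proj₂ (z∈face T PT) _ (u∈Δ T PT)
        by-cases (no ¬PT) = ≤-reflexive (cong (w ·_) (trans (u-zero T ¬PT) (sym (z-zero T ¬PT))))

-- Otherwise replacing the T-summand by a better point of Δ_T would increase w on the sum.
inFace-summand : InFace (MinkowskiSimplexSum P) w (total z) → Decomposition P z → P T →
                 InFace (InSimplex T) w (z T)
inFace-summand {w = w} {z} {T} (_ , maximal) z-dec PT =
  proj₁ z-dec T PT , λ y y∈Δ → ≮⇒≥ λ zT<y →
    <-irrefl refl (<-≤-trans
      (·-sumP-mono-< w (improves (<⇒≤ zT<y)) (∈-allSubsets T)
        (subst (w · z T <_) (cong (w ·_) (sym (update-here z T y))) zT<y))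
      (maximal _ (decomposition⇒∈sum (update-decomposition z-dec PT y∈Δ))))
  where
    improves : w · z T ≤ w · y → ∀ S → w · z S ≤ w · update z T y S
    improves le = update-preserves (λ S x → w · z S ≤ w · x) (λ _ → ≤-refl) le

ArgmaxIncluded : (Subset n → Set) → Point n → Point n → Set
ArgmaxIncluded P w w' = ∀ T → P T → ∀ i → IsArgmax w T i → IsArgmax w' T i

FaceIncluded : (Point n → Set) → Point n → Point n → Set
FaceIncluded Q w w' = ∀ x → InFace Q w x → InFace Q w' x

module _ (P : Subset n → Set) (nonempty : ∀ T → P T → Nonempty T) where

  argmaxIncluded⇒faceIncluded : ArgmaxIncluded P w w' → FaceIncluded (MinkowskiSimplexSum P) w w'
  argmaxIncluded⇒faceIncluded {w} {w'} argmax⊆ _ x∈face@((z , z∈Δ , z-zero , refl) , _) =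
    total-inFace {w = w'} (z∈Δ , z-zero) λ T PT →
      inFace-transfer (nonempty T PT) (argmax⊆ T PT) (inFace-summand {w = w} x∈face (z∈Δ , z-zero) PT)

  module _ (P? : ∀ S → Dec (P S)) (w : Point n) where

    vertices : Subset n → Point n
    vertices S with P? S
    ... | yes PS = e (proj₁ (argmax-exists w (nonempty S PS)))
    ... | no  _  = zeroP

    vertices-inFace : ∀ S → P S → InFace (InSimplex S) w (vertices S)
    vertices-inFace S PS with P? S
    ... | yes PS' = argmax⇒e-inFace (proj₂ (argmax-exists w (nonempty S PS')))
    ... | no  ¬PS = contradiction PS ¬PS

    vertices-zero : ∀ S → ¬ P S → vertices S ≡ zeroP
    vertices-zero S ¬PS with P? S
    ... | yes PS = contradiction PS ¬PS
    ... | no  _  = refl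

    vertices-decomposition : Decomposition P vertices
    vertices-decomposition = (λ S PS → proj₁ (vertices-inFace S PS)) , vertices-zero

  -- P need not be decidable, but the goal is a decidable inequality, so we may decide P on all subsets.
  -- The witness is the w-maximal vertex of the sum whose T-summand is e_i.
  faceIncluded⇒argmaxIncluded : FaceIncluded (MinkowskiSimplexSum P) w w' → ArgmaxIncluded P w w'
  faceIncluded⇒argmaxIncluded {w} {w'} face⊆ T PT i i-argmax@(i∈T , _) =
    i∈T , λ j j∈T →
      ≤-stable (¬¬-map (λ P? → proj₂ (argmax-survives P?) j j∈T) (¬¬-∀-Subset λ _ → ¬¬-excluded-middle))
    where
      argmax-survives : (∀ S → Dec (P S)) → IsArgmax w' T i
      argmax-survives P? = e-inFace⇒argmax i∈T
        (subst (InFace (InSimplex T) w') (update-here (vertices P? w) T (e i))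
          (inFace-summand {w = w'} (face⊆ _ (total-inFace {w = w} zᵢ-dec zᵢ∈face)) zᵢ-dec PT))
        where
          zᵢ : Subset n → Point n
          zᵢ = update (vertices P? w) T (e i)
          zᵢ-dec : Decomposition P zᵢ
          zᵢ-dec = update-decomposition (vertices-decomposition P? w) PT (e-inSimplex i∈T)
          zᵢ∈face : ∀ S → P S → InFace (InSimplex S) w (zᵢ S)
          zᵢ∈face = update-preserves (λ S x → P S → InFace (InSimplex S) w x)
                      (vertices-inFace P? w) (λ _ → argmax⇒e-inFace i-argmax)

  sameNormalCone⇔sameArgmax : SameNormalCone (MinkowskiSimplexSum P) w w' ⇔
                              (ArgmaxIncluded P w w' × ArgmaxIncluded P w' w)
  sameNormalCone⇔sameArgmax = mk⇔
    (λ same → faceIncluded⇒argmaxIncluded (λ x → Equivalence.to (same x)) ,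
              faceIncluded⇒argmaxIncluded (λ x → Equivalence.from (same x)))
    (λ (argmax⊆ , argmax⊇) x →
       mk⇔ (argmaxIncluded⇒faceIncluded argmax⊆ x) (argmaxIncluded⇒faceIncluded argmax⊇ x))

walk-start : WalkIn Γ S u v → u ∈ S
walk-start (here u∈S)     = u∈S
walk-start (step u∈S _ _) = u∈S

_++ʷ_ : WalkIn Γ S u v → WalkIn Γ S v x → WalkIn Γ S u x
here _         ++ʷ q = q
step u∈S adj p ++ʷ q = step u∈S adj (p ++ʷ q)

reverseʷ : WalkIn Γ S u v → WalkIn Γ S v u
reverseʷ (here u∈S) = here u∈S
reverseʷ {Γ = Γ} (step {w = w} u∈S adj p) =
  reverseʷ p ++ʷ step (walk-start p) (trans (SimpleGraph.sym Γ w _) adj) (here u∈S)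

walk-along : ∀ {k} (f : Fin (suc k) → Fin n) → (∀ i → f i ∈ S) →
             (∀ i → Adj Γ (f (inject₁ i)) (f (suc i)) ≡ true) → ∀ b → WalkIn Γ S (f zero) (f b)
walk-along f f∈S adj zero = here (f∈S zero)
walk-along {k = suc k} f f∈S adj (suc b) =
  step (f∈S zero) (adj zero) (walk-along (f ∘ suc) (f∈S ∘ suc) (adj ∘ suc) b)

walk-between : ∀ {k} (f : Fin k → Fin n) → (∀ i → f i ∈ S) →
               (∀ i j → PathAdj i j → Adj Γ (f i) (f j) ≡ true) → ∀ a b → WalkIn Γ S (f a) (f b)
walk-between {Γ = Γ} {k = suc k} f f∈S adj a b =
  reverseʷ (walk-along f f∈S consecutive a) ++ʷ walk-along f f∈S consecutive b
  where
    consecutive : ∀ i → Adj Γ (f (inject₁ i)) (f (suc i)) ≡ true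
    consecutive i = adj (inject₁ i) (suc i) (inj₁ (cong suc (sym (toℕ-inject₁ i))))

inducedIsPath⇒inducedConnected : InducedIsPath Γ S → InducedConnected Γ S
inducedIsPath⇒inducedConnected {Γ = Γ} {S} (nonempty , f , _ , f∈S , f-onto , f-adj) = nonempty , walk
  where
    walk : ∀ u v → u ∈ S → v ∈ S → WalkIn Γ S u v
    walk u v u∈S v∈S with f-onto u u∈S | f-onto v v∈S
    ... | a , refl | b , refl = walk-between f f∈S (λ i j → Equivalence.from (f-adj i j)) a b

listSubset : List (Fin n) → Subset n
listSubset []       = ∅
listSubset (x ∷ xs) = ⁅ x ⁆ ∪ listSubset xs

∈-listSubset⁺ : (xs : List (Fin n)) → x ∈ˡ xs → x ∈ listSubset xs
∈-listSubset⁺ (x ∷ xs) (here refl)  = x∈p∪q⁺ (inj₁ (x∈⁅x⁆ x))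
∈-listSubset⁺ (y ∷ xs) (there x∈xs) = x∈p∪q⁺ (inj₂ (∈-listSubset⁺ xs x∈xs))

∈-listSubset⁻ : (xs : List (Fin n)) → x ∈ listSubset xs → x ∈ˡ xs
∈-listSubset⁻ []       x∈∅ = contradiction x∈∅ ∉⊥
∈-listSubset⁻ (y ∷ xs) x∈S with x∈p∪q⁻ ⁅ y ⁆ (listSubset xs) x∈S
... | inj₁ x∈⁅y⁆ = here (x∈⁅y⁆⇒x≡y y x∈⁅y⁆)
... | inj₂ x∈xs  = there (∈-listSubset⁻ xs x∈xs)

∣⁅x⁆∪p∣ : (x : Fin n) (p : Subset n) → x ∉ p → ∣ ⁅ x ⁆ ∪ p ∣ ≡ suc ∣ p ∣
∣⁅x⁆∪p∣ zero    (true  ∷ p) x∉p = contradiction Vec.here x∉p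
∣⁅x⁆∪p∣ zero    (false ∷ p) x∉p = cong (suc ∘ ∣_∣) (∪-identityˡ p)
∣⁅x⁆∪p∣ (suc x) (true  ∷ p) x∉p = cong suc (∣⁅x⁆∪p∣ x p (x∉p ∘ Vec.there))
∣⁅x⁆∪p∣ (suc x) (false ∷ p) x∉p = ∣⁅x⁆∪p∣ x p (x∉p ∘ Vec.there)

∣listSubset∣ : {xs : List (Fin n)} → Unique xs → ∣ listSubset xs ∣ ≡ length xs
∣listSubset∣ {n} {[]}      []              = ∣⊥∣≡0 n
∣listSubset∣ {xs = x ∷ xs} (x∉xs ∷ unique) =
  trans (∣⁅x⁆∪p∣ x (listSubset xs) (λ x∈S → All.lookup x∉xs (∈-listSubset⁻ xs x∈S) refl))
        (cong suc (∣listSubset∣ unique))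

lookup-injective : {xs : List (Fin n)} → Unique xs → Injective _≡_ _≡_ (lookup xs)
lookup-injective (x∉xs ∷ unique) {zero}  {zero}  _  = refl
lookup-injective (x∉xs ∷ unique) {zero}  {suc j} eq = contradiction eq (All.lookup x∉xs (∈-lookup j))
lookup-injective (x∉xs ∷ unique) {suc i} {zero}  eq = contradiction (sym eq) (All.lookup x∉xs (∈-lookup i))
lookup-injective (x∉xs ∷ unique) {suc i} {suc j} eq = cong suc (lookup-injective unique eq)

pathAdj-suc : {r : ℕ} {i j : Fin r} → PathAdj (suc i) (suc j) ⇔ PathAdj i j
pathAdj-suc = mk⇔ (map⊎ suc-injective suc-injective) (map⊎ (cong suc) (cong suc))

module _ (Γ : SimpleGraph n) where

  ClosedNbhd : Fin n → Fin n → Set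
  ClosedNbhd u x = x ≡ u ⊎ Adj Γ u x ≡ true

  closedNbhd? : ∀ u x → Dec (ClosedNbhd u x)
  closedNbhd? u x = (x Fin.≟ u) ⊎-dec (Adj Γ u x Bool.≟ true)

  adj⇒≢ : Adj Γ u v ≡ true → u ≢ v
  adj⇒≢ {u} adj refl with trans (sym adj) (irrfl Γ u)
  ... | ()

  adj-sym : Adj Γ u v ≡ true ⇔ Adj Γ v u ≡ true
  adj-sym {u} {v} = mk⇔ (trans (SimpleGraph.sym Γ v u)) (trans (SimpleGraph.sym Γ u v))

  data ChordlessPath : Fin n → List (Fin n) → Fin n → Set where
    single : ChordlessPath u [] u
    cons   : ∀ {xs} → Adj Γ u x ≡ true → ¬ Any (ClosedNbhd u) xs → ChordlessPath x xs v →
             ChordlessPath u (x ∷ xs) v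

  ChordlessPathIn : Subset n → Fin n → Fin n → Set
  ChordlessPathIn S u v = ∃ λ xs → ChordlessPath u xs v × All (_∈ S) (u ∷ xs)

  end∈ : ∀ {xs} → ChordlessPath u xs v → v ∈ˡ u ∷ xs
  end∈ single       = here refl
  end∈ (cons _ _ p) = there (end∈ p)

  prepend-near : ∀ {xs} → u ∈ S → ClosedNbhd u x → ¬ Any (ClosedNbhd u) xs → ChordlessPath x xs v →
                 All (_∈ S) (x ∷ xs) → ChordlessPathIn S u v
  prepend-near u∈S (inj₁ refl) _   p p⊆S = _ , p , p⊆S
  prepend-near u∈S (inj₂ adj)  far p p⊆S = _ , cons adj far p , u∈S ∷ p⊆S

  -- u is attached to the last vertex of the path in its closed neighbourhood; what precedes it is dropped.
  prepend : ∀ {xs} → u ∈ S → ChordlessPath x xs v → All (_∈ S) (x ∷ xs) →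
            Any (ClosedNbhd u) (x ∷ xs) → ChordlessPathIn S u v
  prepend u∈S single p⊆S (here near) = prepend-near u∈S near (λ ()) single p⊆S
  prepend {u} u∈S (cons {x = y} {xs = ys} adj far p) (x∈S ∷ p⊆S) near with any? (closedNbhd? u) (y ∷ ys)
  ... | yes near' = prepend u∈S p p⊆S near'
  ... | no  far'  = prepend-near u∈S (Any.head far' near) far' (cons adj far p) (x∈S ∷ p⊆S)

  walk⇒chordlessPath : WalkIn Γ S u v → ChordlessPathIn S u v
  walk⇒chordlessPath (here u∈S) = [] , single , u∈S ∷ []
  walk⇒chordlessPath (step u∈S adj walk) with walk⇒chordlessPath walk
  ... | _ , p , p⊆S = prepend u∈S p p⊆S (here (inj₂ adj))

  chordlessPath-unique : ∀ {xs} → ChordlessPath u xs v → Unique (u ∷ xs)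
  chordlessPath-unique single = [] ∷ []
  chordlessPath-unique (cons adj far p) =
    (adj⇒≢ adj ∷ All.tabulate λ y∈xs u≡y → far (lose y∈xs (inj₁ (sym u≡y)))) ∷ chordlessPath-unique p

  chordlessPath-adj-start : ∀ {xs} → ChordlessPath u xs v → ∀ j →
                            (Adj Γ u (lookup (u ∷ xs) j) ≡ true) ⇔ PathAdj zero j
  chordlessPath-adj-start _              zero          =
    mk⇔ (λ uu → contradiction refl (adj⇒≢ uu)) λ { (inj₁ ()) ; (inj₂ ()) }
  chordlessPath-adj-start (cons adj _ _) (suc zero)    = mk⇔ (λ _ → inj₁ refl) (λ _ → adj)
  chordlessPath-adj-start (cons _ far _) (suc (suc j)) =
    mk⇔ (λ uy → contradiction (lose (∈-lookup j) (inj₂ uy)) far) λ { (inj₁ ()) ; (inj₂ ()) }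

  chordlessPath-adj : ∀ {xs} → ChordlessPath u xs v → ∀ i j →
                      (Adj Γ (lookup (u ∷ xs) i) (lookup (u ∷ xs) j) ≡ true) ⇔ PathAdj i j
  chordlessPath-adj p            zero    j       = chordlessPath-adj-start p j
  chordlessPath-adj p            (suc i) zero    =
    ⇔-trans adj-sym (⇔-trans (chordlessPath-adj-start p (suc i)) (mk⇔ swap swap))
  chordlessPath-adj (cons _ _ p) (suc i) (suc j) = ⇔-trans (chordlessPath-adj p i j) (⇔-sym pathAdj-suc)

inducedIsPath-intro : {k : ℕ} → k ≡ ∣ S ∣ → Nonempty S →
                      (f : Fin k → Fin n) → Injective _≡_ _≡_ f →
                      (∀ i → f i ∈ S) → (∀ v → v ∈ S → ∃ λ i → f i ≡ v) →
                      (∀ i j → (Adj Γ (f i) (f j) ≡ true) ⇔ PathAdj i j) → InducedIsPath Γ S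
inducedIsPath-intro refl nonempty f f-injective f∈S f-onto f-adj = nonempty , f , f-injective , f∈S , f-onto , f-adj

chordlessPath⇒inducedIsPath : {xs : List (Fin n)} → ChordlessPath Γ u xs v →
                              InducedIsPath Γ (listSubset (u ∷ xs))
chordlessPath⇒inducedIsPath {Γ = Γ} {u = u} {xs = xs} p =
  inducedIsPath-intro {Γ = Γ} (sym (∣listSubset∣ unique)) (u , ∈-listSubset⁺ (u ∷ xs) (here refl))
    (lookup (u ∷ xs)) (lookup-injective unique) (λ i → ∈-listSubset⁺ (u ∷ xs) (∈-lookup i)) onto
    (chordlessPath-adj Γ p)
  where
    unique : Unique (u ∷ xs)
    unique = chordlessPath-unique Γ p
    onto : ∀ y → y ∈ listSubset (u ∷ xs) → ∃ λ i → lookup (u ∷ xs) i ≡ y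
    onto y y∈S = Any.index y∈xs , sym (lookup-index y∈xs)
      where
        y∈xs : y ∈ˡ u ∷ xs
        y∈xs = ∈-listSubset⁻ (u ∷ xs) y∈S

inducedConnected⇒inducedPathThrough : InducedConnected Γ S → u ∈ S → v ∈ S →
                                      ∃ λ T → T ⊆ S × u ∈ T × v ∈ T × InducedIsPath Γ T
inducedConnected⇒inducedPathThrough {Γ = Γ} {u = u} {v} (_ , walks) u∈S v∈S
  with walk⇒chordlessPath Γ (walks u v u∈S v∈S)
... | xs , p , p⊆S =
  listSubset (u ∷ xs) , (λ y∈T → All.lookup p⊆S (∈-listSubset⁻ (u ∷ xs) y∈T)) ,
  ∈-listSubset⁺ (u ∷ xs) (here refl) , ∈-listSubset⁺ (u ∷ xs) (end∈ Γ p) ,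
  chordlessPath⇒inducedIsPath p

argmaxIncluded-connected⇔path : (Γ : SimpleGraph n) →
  ArgmaxIncluded (InducedConnected Γ) w w' ⇔ ArgmaxIncluded (InducedIsPath Γ) w w'
argmaxIncluded-connected⇔path {w = w} {w'} Γ = mk⇔
  (λ argmax⊆ T path → argmax⊆ T (inducedIsPath⇒inducedConnected path))
  (λ argmax⊆ T connected i (i∈T , i-max) → i∈T , λ j j∈T → via-path argmax⊆ connected i∈T j∈T i-max)
  where
    via-path : ArgmaxIncluded (InducedIsPath Γ) w w' → InducedConnected Γ T → i ∈ T → j ∈ T →
               (∀ k → k ∈ T → w k ≤ w i) → w' j ≤ w' i
    via-path {i = i} {j} argmax⊆ connected i∈T j∈T i-max
      with inducedConnected⇒inducedPathThrough connected i∈T j∈T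
    ... | T' , T'⊆T , i∈T' , j∈T' , path =
      proj₂ (argmax⊆ T' path i (i∈T' , λ k k∈T' → i-max k (T'⊆T k∈T'))) j j∈T'

mainTheorem7 : (n : ℕ) (Γ : SimpleGraph n) → Connected Γ → NormallyEquivalent (Q-Γ Γ) (QL-Γ Γ)
mainTheorem7 n Γ _ w w' =
  ⇔-trans (sameNormalCone⇔sameArgmax (InducedConnected Γ) (λ _ → proj₁) {w} {w'})
    (⇔-trans (argmaxIncluded-connected⇔path Γ ×-⇔ argmaxIncluded-connected⇔path Γ)
      (⇔-sym (sameNormalCone⇔sameArgmax (InducedIsPath Γ) (λ _ → proj₁) {w} {w'})))
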